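{- Let $K_{a,b}$ be the complete bipartite graph with sides $L$ ($|L|=a$) and $R$ ($|R|=b$). Let $\sigma$ be a confined position of the parallel chip-firing game on $K_{a,b}$ and let $v,w\in L$ with $\sigma(v)\le\sigma(w)$. Then for all $t\ge 0$, $$u_t(\sigma,v)\le u_t(\sigma,w)\le u_t(\sigma,v)+1.$$
   Context: Parallel chip-firing game on a graph $G$: a position $\sigma$ assigns a nonnegative integer $\sigma(v)$ to each vertex; at each step every vertex $v$ with at least $\deg(v)$ chips simultaneously sends one chip to each neighbor. $U$ is the step operator. $\Phi_\sigma(v)$ is the number of neighbors $w$ of $v$ with $\sigma(w)\ge\deg(w)$. A position is confined if every vertex satisfies $\Phi_\sigma(v)\le\sigma(v)\le\Phi_\sigma(v)+\deg(v)-1$. $u_t(\sigma,v)=|\{s:0\le s<t,\ U^s\sigma(v)\ge\deg(v)\}|$. In $K_{a,b}$ every vertex of $L$ is adjacent exactly to all vertices of $R$ and vice versa. -}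

module Defs where

import Data.Nat
import Data.Bool
open import Data.Nat using (ℕ; zero; suc; _≤_; _≤ᵇ_)
open import Data.Bool using (Bool; true; false)
open import Data.Fin using (Fin; _↑ˡ_; _↑ʳ_; splitAt)
open import Data.Sum using (inj₁; inj₂)
open import Data.List using (List; filter; length; allFin)
open import Relation.Binary.PropositionalEquality using (_≡_)
open import Relation.Nullary.Decidable using (yes; no)
open import Data.Bool.Properties using () renaming (_≟_ to _≟ᵇ_)

record Graph (n : ℕ) : Set where
  field
    adj   : Fin n → Fin n → Bool
    symm  : ∀ x y → adj x y ≡ adj y x
    irref : ∀ x → adj x x ≡ false
open Graph public

nbrs : ∀ {n} → Graph n → Fin n → List (Fin n)
nbrs G v = filter (λ w → adj G v w ≟ᵇ true) (allFin _)

deg : ∀ {n} → Graph n → Fin n → ℕ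
deg G v = length (nbrs G v)

Position : ℕ → Set
Position n = Fin n → ℕ

fires? : ∀ {n} → Graph n → Position n → Fin n → Bool
fires? G σ v = deg G v ≤ᵇ σ v

Φ : ∀ {n} → Graph n → Position n → Fin n → ℕ
Φ G σ v = length (filter (λ w → fires? G σ w ≟ᵇ true) (nbrs G v))

U : ∀ {n} → Graph n → Position n → Position n
U G σ v with fires? G σ v
... | true  = (σ v Data.Nat.∸ deg G v) Data.Nat.+ Φ G σ v
... | false = σ v Data.Nat.+ Φ G σ v

Uⁿ : ∀ {n} → Graph n → ℕ → Position n → Position n
Uⁿ G zero    σ = σ
Uⁿ G (suc s) σ = Uⁿ G s (U G σ)

Confined : ∀ {n} → Graph n → Position n → Set
Confined G σ = ∀ v → (Φ G σ v ≤ σ v)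
                   Data.Product.× (σ v Data.Nat.+ 1 ≤ Φ G σ v Data.Nat.+ deg G v)
  where import Data.Product

u : ∀ {n} → Graph n → ℕ → Position n → Fin n → ℕ
u G zero    σ v = 0
u G (suc t) σ v with fires? G (Uⁿ G t σ) v
... | true  = suc (u G t σ v)
... | false = u G t σ v

-- Complete bipartite graph K_{a,b} on Fin (a + b):
-- L = { i ↑ˡ b : i : Fin a },  R = { a ↑ʳ j : j : Fin b }

side : ∀ {a b} → Fin (a Data.Nat.+ b) → Bool   -- true = in L
side {a} {b} x with splitAt a {b} x
... | inj₁ _ = true
... | inj₂ _ = false

Kadj : ∀ a b → Fin (a Data.Nat.+ b) → Fin (a Data.Nat.+ b) → Bool
Kadj a b x y = Data.Bool._xor_ (side {a} {b} x) (side {a} {b} y)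

K : (a b : ℕ) → Graph (a Data.Nat.+ b)
K a b = record { adj = Kadj a b ; symm = λ x y → xor-comm (side {a} {b} x) (side {a} {b} y) ; irref = λ x → xor-same (side {a} {b} x) }
  where
    xor-comm : ∀ p q → Data.Bool._xor_ p q ≡ Data.Bool._xor_ q p
    xor-comm true true = _≡_.refl
    xor-comm true false = _≡_.refl
    xor-comm false true = _≡_.refl
    xor-comm false false = _≡_.refl
    xor-same : ∀ p → Data.Bool._xor_ p p ≡ false
    xor-same true = _≡_.refl
    xor-same false = _≡_.refl

module Submission where

-- Two vertices v, w of a graph are *twins* when they have the same
-- neighbours.  Twins have the same degree and, in every position, receive
-- the same number of chips Φ.  Hence, as long as we only look at the pair,
-- the parallel chip-firing game on two twins is a scalar dynamics with
-- common threshold D and common income F at each step: a vertex holding x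
-- chips goes to x ∸ D + F (if D ≤ x) or to x + F.
--
-- For this scalar dynamics we isolate an invariant, `Balanced`: either
-- both vertices have fired equally often and w holds between 0 and D − 1
-- chips more than v, or w has fired exactly once more and v holds between
-- 1 and D chips more than w.  It is preserved by the firing phase (a case
-- analysis on who fires) and by the receiving phase (adding F to both).
-- Since it bounds the firing counts, the invariant yields
-- u_t(v) ≤ u_t(w) ≤ u_t(v) + 1 for twins with σ v ≤ σ w < σ v + deg v.
--
-- Finally two left vertices of K_{a,b} are twins, and confinement of σ
-- gives σ w < σ v + deg v, which proves Lemma 3.1.

import Data.Nat
open import Defs
open import Data.Nat using (ℕ; zero; suc; _+_; _∸_; _≤_; _<_; _≤ᵇ_)
open import Data.Fin using (Fin; _↑ˡ_)
open import Data.Nat.Properties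
open import Data.Bool using (true; false; _xor_)
open import Data.Bool.Properties using () renaming (_≟_ to _≟ᵇ_)
open import Data.Product using (_×_; _,_; proj₁; proj₂)
open import Data.List using (filter; length; allFin)
open import Data.List.Properties using (filter-≐)
open import Data.Fin.Properties using (splitAt-↑ˡ)
open import Relation.Binary.PropositionalEquality
open import Relation.Nullary.Reflects using (ofʸ; ofⁿ)
open import Relation.Nullary.Negation using (contradiction)

afterFiring : ℕ → ℕ → ℕ
afterFiring D x with D ≤ᵇ x
... | true  = x ∸ D
... | false = x

tally : ℕ → ℕ → ℕ → ℕ
tally D x p with D ≤ᵇ x
... | true  = suc p
... | false = p

data Balanced (D : ℕ) : ℕ → ℕ → ℕ → ℕ → Set where
  level : ∀ {x y p} → x ≤ y → y < D + x → Balanced D x y p p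
  ahead : ∀ {x y p} → y < x → x ≤ D + y → Balanced D x y p (suc p)

Balanced-resp : ∀ {D x y p q x′ y′ p′ q′} → x ≡ x′ → y ≡ y′ → p ≡ p′ → q ≡ q′ →
                Balanced D x y p q → Balanced D x′ y′ p′ q′
Balanced-resp refl refl refl refl b = b

balanced-counts : ∀ {D x y p q} → Balanced D x y p q → p ≤ q × q ≤ suc p
balanced-counts (level _ _) = ≤-refl , n≤1+n _
balanced-counts (ahead _ _) = n≤1+n _ , ≤-refl

balanced-receive : ∀ {D x y p q} F → Balanced D x y p q →
                   Balanced D (x + F) (y + F) p q
balanced-receive {D} {x} {y} F (level x≤y y<D+x) =
  level (+-monoˡ-≤ F x≤y) (subst (y + F <_) (+-assoc D x F) (+-monoˡ-< F y<D+x))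
balanced-receive {D} {x} {y} F (ahead y<x x≤D+y) =
  ahead (+-monoˡ-< F y<x) (subst (x + F ≤_) (+-assoc D y F) (+-monoˡ-≤ F x≤D+y))

fired-below : ∀ {D x y} → D ≤ y → y < D + x → y ∸ D < x
fired-below {D} {x} D≤y y<D+x = subst (_ <_) (m+n∸m≡n D x) (∸-monoˡ-< y<D+x D≤y)

-- The firing phase preserves the invariant; the two cases where only the
-- vertex with fewer chips fires are impossible.
balanced-fire : ∀ {D x y p q} → Balanced D x y p q →
  Balanced D (afterFiring D x) (afterFiring D y) (tally D x p) (tally D y q)
balanced-fire {D} {x} {y} b
  with D ≤ᵇ x | ≤ᵇ-reflects-≤ D x | D ≤ᵇ y | ≤ᵇ-reflects-≤ D y | b
... | true  | ofʸ D≤x | true  | ofʸ D≤y | level x≤y y<D+x =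
  level (∸-monoˡ-≤ D x≤y) (subst (_ <_) (sym (m+[n∸m]≡n D≤x)) (fired-below D≤y y<D+x))
... | true  | ofʸ D≤x | false | ofⁿ D≰y | level x≤y _ = contradiction (≤-trans D≤x x≤y) D≰y
... | false | ofⁿ _   | true  | ofʸ D≤y | level x≤y y<D+x =
  ahead (fired-below D≤y y<D+x) (subst (x ≤_) (sym (m+[n∸m]≡n D≤y)) x≤y)
... | false | ofⁿ _   | false | ofⁿ _   | level x≤y y<D+x = level x≤y y<D+x
... | true  | ofʸ D≤x | true  | ofʸ D≤y | ahead y<x x≤D+y =
  ahead (∸-monoˡ-< y<x D≤y) (subst (_ ≤_) (sym (m+[n∸m]≡n D≤y)) (m≤n+o⇒m∸n≤o x D x≤D+y))
... | true  | ofʸ D≤x | false | ofⁿ _   | ahead y<x x≤D+y =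
  level (m≤n+o⇒m∸n≤o x D x≤D+y) (subst (y <_) (sym (m+[n∸m]≡n D≤x)) y<x)
... | false | ofⁿ D≰x | true  | ofʸ D≤y | ahead y<x _ = contradiction (≤-trans D≤y (<⇒≤ y<x)) D≰x
... | false | ofⁿ _   | false | ofⁿ _   | ahead y<x x≤D+y = ahead y<x x≤D+y

balanced-step : ∀ {D x y p q} F → Balanced D x y p q →
  Balanced D (afterFiring D x + F) (afterFiring D y + F) (tally D x p) (tally D y q)
balanced-step F b = balanced-receive F (balanced-fire b)

module _ {n : ℕ} (G : Graph n) where

  U-split : ∀ τ v → U G τ v ≡ afterFiring (deg G v) (τ v) + Φ G τ v
  U-split τ v with deg G v ≤ᵇ τ v
  ... | true  = refl
  ... | false = refl

  u-suc : ∀ t σ v → u G (suc t) σ v ≡ tally (deg G v) (Uⁿ G t σ v) (u G t σ v)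
  u-suc t σ v with deg G v ≤ᵇ Uⁿ G t σ v
  ... | true  = refl
  ... | false = refl

  -- Uⁿ iterates on the inside; the invariant needs the outer unfolding.
  Uⁿ-suc : ∀ t σ → Uⁿ G (suc t) σ ≡ U G (Uⁿ G t σ)
  Uⁿ-suc zero    σ = refl
  Uⁿ-suc (suc t) σ = Uⁿ-suc t (U G σ)

  Twins : Fin n → Fin n → Set
  Twins v w = ∀ x → adj G v x ≡ adj G w x

  module _ {v w : Fin n} (twins : Twins v w) where

    twin-nbrs : nbrs G v ≡ nbrs G w
    twin-nbrs = filter-≐ (λ x → adj G v x ≟ᵇ true) (λ x → adj G w x ≟ᵇ true)
                  ((λ {x} e → trans (sym (twins x)) e) , (λ {x} e → trans (twins x) e))
                  (allFin n)

    twin-deg : deg G v ≡ deg G w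
    twin-deg = cong length twin-nbrs

    twin-Φ : ∀ τ → Φ G τ v ≡ Φ G τ w
    twin-Φ τ = cong (λ ns → length (filter (λ x → fires? G τ x ≟ᵇ true) ns)) twin-nbrs

    twin-U : ∀ τ → U G τ w ≡ afterFiring (deg G v) (τ w) + Φ G τ v
    twin-U τ = trans (U-split τ w)
      (cong₂ (λ D F → afterFiring D (τ w) + F) (sym twin-deg) (sym (twin-Φ τ)))

    twin-u : ∀ t σ → u G (suc t) σ w ≡ tally (deg G v) (Uⁿ G t σ w) (u G t σ w)
    twin-u t σ = trans (u-suc t σ w) (cong (λ D → tally D (Uⁿ G t σ w) (u G t σ w)) (sym twin-deg))

    twins-balanced : ∀ σ → σ v ≤ σ w → σ w < deg G v + σ v → ∀ t →
      Balanced (deg G v) (Uⁿ G t σ v) (Uⁿ G t σ w) (u G t σ v) (u G t σ w)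
    twins-balanced σ σv≤σw σw<D+σv zero = level σv≤σw σw<D+σv
    twins-balanced σ σv≤σw σw<D+σv (suc t) =
      Balanced-resp (sym (trans (cong-app (Uⁿ-suc t σ) v) (U-split τ v)))
                    (sym (trans (cong-app (Uⁿ-suc t σ) w) (twin-U τ)))
                    (sym (u-suc t σ v)) (sym (twin-u t σ))
                    (balanced-step (Φ G τ v) (twins-balanced σ σv≤σw σw<D+σv t))
      where τ = Uⁿ G t σ

    twins-firing-counts : ∀ σ → σ v ≤ σ w → σ w < deg G v + σ v → ∀ t →
      (u G t σ v ≤ u G t σ w) × (u G t σ w ≤ suc (u G t σ v))
    twins-firing-counts σ σv≤σw σw<D+σv t =
      balanced-counts (twins-balanced σ σv≤σw σw<D+σv t)

    confined-twin-gap : ∀ σ → Confined G σ → σ w < deg G v + σ v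
    confined-twin-gap σ conf = begin
      suc (σ w)             ≡⟨ +-comm 1 (σ w) ⟩
      σ w + 1               ≤⟨ proj₂ (conf w) ⟩
      Φ G σ w + deg G w     ≡⟨ cong₂ _+_ (sym (twin-Φ σ)) (sym twin-deg) ⟩
      Φ G σ v + deg G v     ≤⟨ +-monoˡ-≤ (deg G v) (proj₁ (conf v)) ⟩
      σ v + deg G v         ≡⟨ +-comm (σ v) (deg G v) ⟩
      deg G v + σ v         ∎
      where open ≤-Reasoning

left-twins : ∀ a b (i j : Fin a) → Twins (K a b) (i ↑ˡ b) (j ↑ˡ b)
left-twins a b i j x = cong (_xor side {a} {b} x) (trans (left-side i) (sym (left-side j)))
  where
    left-side : ∀ k → side {a} {b} (k ↑ˡ b) ≡ true
    left-side k rewrite splitAt-↑ˡ a k b = refl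

lemma3p1 : (a b : ℕ) (σ : Position (a Data.Nat.+ b)) → Confined (K a b) σ →
    (i j : Fin a) → σ (i ↑ˡ b) ≤ σ (j ↑ˡ b) → (t : ℕ) →
    (u (K a b) t σ (i ↑ˡ b) ≤ u (K a b) t σ (j ↑ˡ b))
    × (u (K a b) t σ (j ↑ˡ b) ≤ suc (u (K a b) t σ (i ↑ˡ b)))
lemma3p1 a b σ conf i j σi≤σj =
  twins-firing-counts (K a b) twins σ σi≤σj (confined-twin-gap (K a b) twins σ conf)
  where twins = left-twins a b i j
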